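{- Let $\mathcal{S}$ be a countable signature and $\mathcal{A}=(A,I)$ a negation-closed $\mathcal{S}$-structure. From a given $\mathsf{CTL}^*(\mathcal{S})$ state formula $\varphi$ one can compute a $\mathsf{CTL}^*(\mathcal{S})$ state formula $\varphi'$ in strong negation normal form such that $\varphi$ is $\mathcal{A}$-satisfiable if and only if $\varphi'$ is $\mathcal{A}$-satisfiable.
   Context: $\mathcal{A}$ is negation-closed if there is a computable function mapping each $r\in\mathcal{S}$ to a positive existential first-order formula $\varphi_r(x_1,\dots,x_{\mathrm{ar}(r)})$ over $\mathcal{S}$ (built from atomic formulas using only $\wedge,\vee,\exists$) with $A^{\mathrm{ar}(r)}\setminus I(r)=\{\bar a:\mathcal{A}\models\varphi_r(\bar a)\}$. $\mathsf{CTL}^*$ with constraints: fix countably infinite sets $\mathsf{P}$ (propositions) and $\mathsf{V}$ (variables). $\mathsf{CTL}^*(\mathcal{S})$ state formulas $\phi$ and path formulas $\psi$ are given by $\phi::=p\mid\neg\phi\mid(\phi\wedge\phi)\mid\mathsf{E}\psi$ and $\psi::=\phi\mid\neg\psi\mid(\psi\wedge\psi)\mid\mathsf{X}\psi\mid\psi\,\mathsf{U}\,\psi\mid r(\mathsf{X}^{i_1}x_1,\dots,\mathsf{X}^{i_k}x_k)$ where $p\in\mathsf{P}$, $r\in\mathcal{S}$, $k=\mathrm{ar}(r)$, $i_j\ge 0$, $x_j\in\mathsf{V}$; formulas $r(\dots)$ are atomic constraints. Abbreviations: $\theta_1\vee\theta_2:=\neg(\neg\theta_1\wedge\neg\theta_2)$,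 $\mathsf{A}\psi:=\neg\mathsf{E}\neg\psi$, $\psi_1\mathsf{R}\psi_2:=\neg(\neg\psi_1\mathsf{U}\neg\psi_2)$. A formula is in negation normal form if it uses these extended operators and $\neg$ occurs only in front of atomic propositions or atomic constraints; it is in strong negation normal form if moreover $\neg$ occurs only in front of atomic propositions. A Kripke structure is $\mathcal{K}=(D,\to,\rho)$ with $\to\subseteq D\times D$ such that every node has a successor, and $\rho:D\to 2^{\mathsf{P}}$ with $\bigcup_{v}\rho(v)$ finite. A $\mathcal{K}$-path is an infinite sequence $\pi=(v_0,v_1,\dots)$ with $v_i\to v_{i+1}$; $\pi(i)=v_i$, $\pi^i=(v_i,v_{i+1},\dots)$. An $\mathcal{A}$-constraint graph is $\mathcal{C}=(\mathcal{A},\mathcal{K},\gamma)$ with $\gamma:D\times\mathsf{V}\to A$. Semantics: $(\mathcal{C},v)\models p$ iff $p\in\rho(v)$; Boolean connectives as usual; $(\mathcal{C},v)\models\mathsf{E}\psi$ iff some $\mathcal{K}$-path $\pi$ with $\pi(0)=v$ has $(\mathcal{C},\pi)\models\psi$; for a state formula $\phi$, $(\mathcal{C},\pi)\models\phi$ iff $(\mathcal{C},\pi(0))\models\phi$; $(\mathcal{C},\pi)\models\mathsf{X}\psi$ iff $(\mathcal{C},\pi^1)\models\psi$; $(\mathcal{C},\pi)\models\psi_1\mathsf{U}\psi_2$ iff there is $i\ge0$ with $(\mathcal{C},\pi^i)\models\psi_2$ and $(\mathcal{C},\pi^j)\models\psi_1$ for all $j<i$; $(\mathcal{C},\pi)\models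 r(\mathsf{X}^{i_1}x_1,\dots,\mathsf{X}^{i_k}x_k)$ iff $(\gamma(\pi(i_1),x_1),\dots,\gamma(\pi(i_k),x_k))\in I(r)$. A state formula is $\mathcal{A}$-satisfiable if $(\mathcal{C},v)\models\phi$ for some $\mathcal{A}$-constraint graph $\mathcal{C}$ and node $v$. -}

module Defs where

open import Data.Nat using (ℕ; zero; suc; _<_; _+_)
open import Data.Nat.Properties using (+-suc)
open import Data.Fin using (Fin)
open import Data.Vec using (Vec; []; _∷_; map; lookup)
open import Data.Vec.Relation.Unary.All using (All)
open import Data.Product using (Σ; _×_; _,_; proj₁; proj₂; ∃)
open import Data.Sum using (_⊎_)
open import Data.Bool using (Bool; true)
open import Relation.Binary.PropositionalEquality using (_≡_)
open import Relation.Nullary using (¬_)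
open import Function.Bundles using (_⇔_)

-- A countable relational signature: a type of relation symbols with arities,
-- together with an injection into ℕ (countability).
record Signature : Set₁ where
  field
    Sym       : Set
    ar        : Sym → ℕ
    enc       : Sym → ℕ
    enc-inj   : ∀ r s → enc r ≡ enc s → r ≡ s

open Signature public

record Structure (S : Signature) : Set₁ where
  field
    Carrier : Set
    I       : (r : Sym S) → Vec Carrier (ar S r) → Set

open Structure public

data PosEx (S : Signature) : ℕ → Set where
  atom : ∀ {n} (r : Sym S) → Vec (Fin n) (ar S r) → PosEx S n
  _∧ᶠ_ : ∀ {n} → PosEx S n → PosEx S n → PosEx S n
  _∨ᶠ_ : ∀ {n} → PosEx S n → PosEx S n → PosEx S n
  ∃ᶠ   : ∀ {n} → PosEx S (suc n) → PosEx S n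

module _ {S : Signature} (𝒜 : Structure S) where
  ⟦_⟧ᶠ : ∀ {n} → PosEx S n → Vec (Carrier 𝒜) n → Set
  ⟦ atom r xs ⟧ᶠ env = I 𝒜 r (map (λ x → lookup env x) xs)
  ⟦ φ ∧ᶠ ψ ⟧ᶠ env = ⟦ φ ⟧ᶠ env × ⟦ ψ ⟧ᶠ env
  ⟦ φ ∨ᶠ ψ ⟧ᶠ env = ⟦ φ ⟧ᶠ env ⊎ ⟦ ψ ⟧ᶠ env
  ⟦ ∃ᶠ φ ⟧ᶠ env = Σ (Carrier 𝒜) λ a → ⟦ φ ⟧ᶠ (a ∷ env)

-- Negation-closedness: a (computable = Agda) map r ↦ φ_r such that
-- φ_r defines the complement of I(r).
NegationClosed : {S : Signature} → Structure S → Set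
NegationClosed {S} 𝒜 =
  Σ ((r : Sym S) → PosEx S (ar S r)) λ φ →
    ∀ (r : Sym S) (a : Vec (Carrier 𝒜) (ar S r)) → ((¬ I 𝒜 r a) ⇔ ⟦_⟧ᶠ 𝒜 (φ r) a)

Prop : Set
Prop = ℕ

Var : Set
Var = ℕ

mutual
  data StateF (S : Signature) : Set where
    prop : Prop → StateF S
    ¬ₛ_  : StateF S → StateF S
    _∧ₛ_ : StateF S → StateF S → StateF S
    E    : PathF S → StateF S

  data PathF (S : Signature) : Set where
    st   : StateF S → PathF S
    ¬ₚ_  : PathF S → PathF S
    _∧ₚ_ : PathF S → PathF S → PathF S
    X    : PathF S → PathF S
    _U_  : PathF S → PathF S → PathF S
    -- r(X^{i_1} x_1, ..., X^{i_k} x_k): each argument is a pair (i_j , x_j)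
    constr : (r : Sym S) → Vec (ℕ × Var) (ar S r) → PathF S

_∨ₛ_ : ∀ {S} → StateF S → StateF S → StateF S
φ ∨ₛ ψ = ¬ₛ ((¬ₛ φ) ∧ₛ (¬ₛ ψ))

A : ∀ {S} → PathF S → StateF S
A ψ = ¬ₛ (E (¬ₚ ψ))

_∨ₚ_ : ∀ {S} → PathF S → PathF S → PathF S
φ ∨ₚ ψ = ¬ₚ ((¬ₚ φ) ∧ₚ (¬ₚ ψ))

_R_ : ∀ {S} → PathF S → PathF S → PathF S
ψ₁ R ψ₂ = ¬ₚ ((¬ₚ ψ₁) U (¬ₚ ψ₂))

mutual
  data SNNFₛ {S : Signature} : StateF S → Set where
    prop    : ∀ p → SNNFₛ (prop p)
    negprop : ∀ p → SNNFₛ (¬ₛ (prop p))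
    and     : ∀ {φ ψ} → SNNFₛ φ → SNNFₛ ψ → SNNFₛ (φ ∧ₛ ψ)
    or      : ∀ {φ ψ} → SNNFₛ φ → SNNFₛ ψ → SNNFₛ (φ ∨ₛ ψ)
    exists  : ∀ {ψ} → SNNFₚ ψ → SNNFₛ (E ψ)
    all     : ∀ {ψ} → SNNFₚ ψ → SNNFₛ (A ψ)

  data SNNFₚ {S : Signature} : PathF S → Set where
    state   : ∀ {φ} → SNNFₛ φ → SNNFₚ (st φ)
    and     : ∀ {φ ψ} → SNNFₚ φ → SNNFₚ ψ → SNNFₚ (φ ∧ₚ ψ)
    or      : ∀ {φ ψ} → SNNFₚ φ → SNNFₚ ψ → SNNFₚ (φ ∨ₚ ψ)
    next    : ∀ {ψ} → SNNFₚ ψ → SNNFₚ (X ψ)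
    until   : ∀ {φ ψ} → SNNFₚ φ → SNNFₚ ψ → SNNFₚ (φ U ψ)
    release : ∀ {φ ψ} → SNNFₚ φ → SNNFₚ ψ → SNNFₚ (φ R ψ)
    constr  : ∀ r args → SNNFₚ (constr r args)

record Kripke : Set₁ where
  field
    D       : Set
    _⇒_     : D → D → Set
    total   : ∀ v → ∃ λ w → v ⇒ w
    ρ       : D → Prop → Bool
    ρ-fin   : ∃ λ N → ∀ v p → ρ v p ≡ true → p < N

open Kripke public

record KPath (K : Kripke) : Set where
  field
    seq   : ℕ → D K
    valid : ∀ i → _⇒_ K (seq i) (seq (suc i))

open KPath public

suffix : ∀ {K} → KPath K → ℕ → KPath K
seq   (suffix π n) i = seq π (n + i)
valid (suffix π n) i rewrite +-suc n i = valid π (n + i)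

record ConstraintGraph {S : Signature} (𝒜 : Structure S) : Set₁ where
  field
    K : Kripke
    γ : D K → Var → Carrier 𝒜

open ConstraintGraph public

module Semantics {S : Signature} {𝒜 : Structure S} (C : ConstraintGraph 𝒜) where
  mutual
    _⊨ₛ_ : D (K C) → StateF S → Set
    v ⊨ₛ prop p = ρ (K C) v p ≡ true
    v ⊨ₛ (¬ₛ φ) = ¬ (v ⊨ₛ φ)
    v ⊨ₛ (φ ∧ₛ ψ) = (v ⊨ₛ φ) × (v ⊨ₛ ψ)
    v ⊨ₛ E ψ = Σ (KPath (K C)) λ π → (seq π 0 ≡ v) × (π ⊨ₚ ψ)

    _⊨ₚ_ : KPath (K C) → PathF S → Set
    π ⊨ₚ st φ = seq π 0 ⊨ₛ φ
    π ⊨ₚ (¬ₚ ψ) = ¬ (π ⊨ₚ ψ)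
    π ⊨ₚ (ψ₁ ∧ₚ ψ₂) = (π ⊨ₚ ψ₁) × (π ⊨ₚ ψ₂)
    π ⊨ₚ X ψ = suffix π 1 ⊨ₚ ψ
    π ⊨ₚ (ψ₁ U ψ₂) =
      Σ ℕ λ i → (suffix π i ⊨ₚ ψ₂) × (∀ j → j < i → suffix π j ⊨ₚ ψ₁)
    π ⊨ₚ constr r args =
      I 𝒜 r (map (λ ix → γ C (seq π (proj₁ ix)) (proj₂ ix)) args)

open Semantics public

Satisfiable : {S : Signature} → Structure S → StateF S → Set₁
Satisfiable 𝒜 φ = Σ (ConstraintGraph 𝒜) λ C → Σ (D (K C)) λ v → _⊨ₛ_ C v φ

-- Negations are pushed inwards with the CTL* dualities (¬E = A¬, ¬U = R¬, De Morgan),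
-- so only negated atomic constraints ¬ r(t₁,…,tₖ) remain. Such a constraint is replaced
-- by the positive existential formula φ_r defining the complement of I(r), its bound
-- variables becoming fresh variables read at the latest time m among the tᵢ. The formula
-- obtained is then equisatisfiable: a model of it yields a model of the original by
-- renaming variables back; conversely, unfold a model of the original into its tree of
-- histories, where a node at time m remembers the values of all tᵢ and can therefore
-- carry witnesses for the existential quantifiers of φ_r as the values of the fresh
-- variables. The fresh variables are indexed by the constraint and by the position of the
-- quantifier, and all variables are coded injectively into ℕ.

module Submission where

open import Defs hiding (_⊨ₛ_; _⊨ₚ_)
open import Level using (0ℓ)
open import Axiom.ExcludedMiddle using (ExcludedMiddle)
open import Axiom.DoubleNegationElimination using (em⇒dne)
open import Data.Nat using (ℕ; zero; suc; _+_; _∸_; _⊔_; _≤_)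
open import Data.Nat.Properties using (m≤m⊔n; m≤n⊔m; ≤-trans; ≤-refl; m∸n+n≡m)
open import Data.Nat.Binary using (ℕᵇ; 2[1+_]; 1+[2_]) renaming (zero to 0ᵇ; toℕ to toℕᵇ)
open import Data.Nat.Binary.Properties using (toℕ-injective; 1+[2_]-injective)
open import Data.Fin using (Fin)
open import Data.List using (List; []; _∷_; _++_)
open import Data.List.Properties using (∷-injective; ∷-injectiveˡ; ∷-injectiveʳ)
open import Data.Vec using (Vec; []; _∷_; map; lookup)
open import Data.Vec.Properties using (map-∘; lookup-map; map-cong)
open import Data.Product using (Σ; _×_; _,_; proj₁; proj₂)
open import Data.Sum using (inj₁; inj₂)
open import Data.Empty using (⊥-elim)
open import Function using (_∘_)
open import Function.Bundles using (_⇔_; mk⇔; Equivalence)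
open import Relation.Nullary using (¬_; yes; no)
open import Relation.Binary.PropositionalEquality
  using (_≡_; refl; sym; trans; cong; cong₂; subst; module ≡-Reasoning)

map-∘-lookup : ∀ {A B : Set} {n k} (f : A → B) (σ : Vec A n) (xs : Vec (Fin n) k) →
  map f (map (lookup σ) xs) ≡ map (lookup (map f σ)) xs
map-∘-lookup f σ xs = begin
  map f (map (lookup σ) xs)    ≡⟨ map-∘ f (lookup σ) xs ⟨
  map (f ∘ lookup σ) xs        ≡⟨ map-cong (λ x → lookup-map x f σ) xs ⟨
  map (lookup (map f σ)) xs    ∎
  where open ≡-Reasoning

-- In bijective base 2 (digits 1+[2_] and 2[1+_]) the list n₁ ∷ n₂ ∷ … becomes the digit
-- string 1ⁿ¹ 2 1ⁿ² 2 …, read from the least significant end.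
encodeCons : ℕ → ℕᵇ → ℕᵇ
encodeCons zero    b = 2[1+ b ]
encodeCons (suc n) b = 1+[2 encodeCons n b ]

encodeCons-injective : ∀ m n {b c} → encodeCons m b ≡ encodeCons n c → m ≡ n × b ≡ c
encodeCons-injective zero    zero    refl = refl , refl
encodeCons-injective zero    (suc n) ()
encodeCons-injective (suc m) zero    ()
encodeCons-injective (suc m) (suc n) eq
  with refl , refl ← encodeCons-injective m n (1+[2_]-injective eq) = refl , refl

encodeList : List ℕ → ℕᵇ
encodeList []      = 0ᵇ
encodeList (n ∷ l) = encodeCons n (encodeList l)

encodeList-injective : ∀ k l → encodeList k ≡ encodeList l → k ≡ l
encodeList-injective []      []            _  = refl
encodeList-injective []      (zero  ∷ _)   ()
encodeList-injective []      (suc _ ∷ _)   ()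
encodeList-injective (zero  ∷ _) []        ()
encodeList-injective (suc _ ∷ _) []        ()
encodeList-injective (m ∷ k) (n ∷ l) eq
  with refl , eq′ ← encodeCons-injective m n eq = cong (m ∷_) (encodeList-injective k l eq′)

listCode : List ℕ → ℕ
listCode l = toℕᵇ (encodeList l)

listCode-injective : ∀ k l → listCode k ≡ listCode l → k ≡ l
listCode-injective k l eq = encodeList-injective k l (toℕ-injective eq)

flatten : ∀ {n} → Vec (ℕ × ℕ) n → List ℕ
flatten []            = []
flatten ((i , x) ∷ ts) = i ∷ x ∷ flatten ts

flatten-++-injective : ∀ {n} (ts us : Vec (ℕ × ℕ) n) {k l} →
  flatten ts ++ k ≡ flatten us ++ l → ts ≡ us × k ≡ l
flatten-++-injective []             []             eq = refl , eq
flatten-++-injective ((i , x) ∷ ts) ((j , y) ∷ us) eq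
  with refl , eq₁ ← ∷-injective eq
  with refl , eq₂ ← ∷-injective eq₁
  with refl , refl ← flatten-++-injective ts us eq₂ = refl , refl

module Translation {S : Signature} {𝒜 : Structure S} (nc : NegationClosed 𝒜) where

  complementFormula : (r : Sym S) → PosEx S (ar S r)
  complementFormula = proj₁ nc

  complement⇔ : ∀ r a → (¬ I 𝒜 r a) ⇔ ⟦_⟧ᶠ 𝒜 (complementFormula r) a
  complement⇔ = proj₂ nc

  -- (i , x) stands for Xⁱ x.
  Term : Set
  Term = ℕ × Var

  maxTime : ∀ {n} → Vec Term n → ℕ
  maxTime []            = 0
  maxTime ((i , _) ∷ ts) = i ⊔ maxTime ts

  termValue : (C : ConstraintGraph 𝒜) → KPath (K C) → Term → Carrier 𝒜
  termValue C π t = γ C (seq π (proj₁ t)) (proj₂ t)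

  data Name : Set where
    orig  : Var → Name
    -- the variable bound by the quantifier at position l of φ_r in ¬ r(ts)
    fresh : (r : Sym S) → Vec Term (ar S r) → List ℕ → Name

  serialise : Name → List ℕ
  serialise (orig x)       = 0 ∷ x ∷ []
  serialise (fresh r ts l) = 1 ∷ enc S r ∷ flatten ts ++ l

  serialise-injective : ∀ a b → serialise a ≡ serialise b → a ≡ b
  serialise-injective (orig x) (orig y) eq = cong orig (∷-injectiveˡ (∷-injectiveʳ eq))
  serialise-injective (orig _) (fresh _ _ _) ()
  serialise-injective (fresh _ _ _) (orig _) ()
  serialise-injective (fresh r ts k) (fresh s us l) eq
    with refl ← enc-inj S r s (∷-injectiveˡ (∷-injectiveʳ eq))
    with refl , refl ← flatten-++-injective ts us (∷-injectiveʳ (∷-injectiveʳ eq)) = refl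

  ⌜_⌝ : Name → Var
  ⌜ a ⌝ = listCode (serialise a)

  ⌜⌝-injective : ∀ a b → ⌜ a ⌝ ≡ ⌜ b ⌝ → a ≡ b
  ⌜⌝-injective a b eq = serialise-injective a b (listCode-injective _ _ eq)

  renameTerm : Term → Term
  renameTerm (i , x) = i , ⌜ orig x ⌝

  -- The free variables of φ are the terms σ, and the quantifier at position l becomes the
  -- variable name l read at time t.
  posPath : ∀ {n} → PosEx S n → Vec Term n → ℕ → (List ℕ → Var) → PathF S
  posPath (atom r xs) σ t name = constr r (map (lookup σ) xs)
  posPath (φ ∧ᶠ ψ)    σ t name = posPath φ σ t (name ∘ (0 ∷_)) ∧ₚ posPath ψ σ t (name ∘ (1 ∷_))
  posPath (φ ∨ᶠ ψ)    σ t name = posPath φ σ t (name ∘ (0 ∷_)) ∨ₚ posPath ψ σ t (name ∘ (1 ∷_))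
  posPath (∃ᶠ φ)      σ t name = posPath φ ((t , name []) ∷ σ) t (name ∘ (0 ∷_))

  negConstr : (r : Sym S) → Vec Term (ar S r) → PathF S
  negConstr r ts = posPath (complementFormula r) (map renameTerm ts) (maxTime ts) (⌜_⌝ ∘ fresh r ts)

  mutual
    nnfₛ⁺ : StateF S → StateF S
    nnfₛ⁺ (prop p)  = prop p
    nnfₛ⁺ (¬ₛ φ)    = nnfₛ⁻ φ
    nnfₛ⁺ (φ ∧ₛ ψ)  = nnfₛ⁺ φ ∧ₛ nnfₛ⁺ ψ
    nnfₛ⁺ (E ψ)     = E (nnfₚ⁺ ψ)

    nnfₛ⁻ : StateF S → StateF S
    nnfₛ⁻ (prop p)  = ¬ₛ (prop p)
    nnfₛ⁻ (¬ₛ φ)    = nnfₛ⁺ φ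
    nnfₛ⁻ (φ ∧ₛ ψ)  = nnfₛ⁻ φ ∨ₛ nnfₛ⁻ ψ
    nnfₛ⁻ (E ψ)     = A (nnfₚ⁻ ψ)

    nnfₚ⁺ : PathF S → PathF S
    nnfₚ⁺ (st φ)          = st (nnfₛ⁺ φ)
    nnfₚ⁺ (¬ₚ ψ)          = nnfₚ⁻ ψ
    nnfₚ⁺ (ψ₁ ∧ₚ ψ₂)      = nnfₚ⁺ ψ₁ ∧ₚ nnfₚ⁺ ψ₂
    nnfₚ⁺ (X ψ)           = X (nnfₚ⁺ ψ)
    nnfₚ⁺ (ψ₁ U ψ₂)       = nnfₚ⁺ ψ₁ U nnfₚ⁺ ψ₂
    nnfₚ⁺ (constr r ts)   = constr r (map renameTerm ts)

    nnfₚ⁻ : PathF S → PathF S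
    nnfₚ⁻ (st φ)          = st (nnfₛ⁻ φ)
    nnfₚ⁻ (¬ₚ ψ)          = nnfₚ⁺ ψ
    nnfₚ⁻ (ψ₁ ∧ₚ ψ₂)      = nnfₚ⁻ ψ₁ ∨ₚ nnfₚ⁻ ψ₂
    nnfₚ⁻ (X ψ)           = X (nnfₚ⁻ ψ)
    nnfₚ⁻ (ψ₁ U ψ₂)       = nnfₚ⁻ ψ₁ R nnfₚ⁻ ψ₂
    nnfₚ⁻ (constr r ts)   = negConstr r ts

  SNNF-posPath : ∀ {n} (φ : PosEx S n) σ t name → SNNFₚ (posPath φ σ t name)
  SNNF-posPath (atom r xs) σ t name = constr r _
  SNNF-posPath (φ ∧ᶠ ψ)    σ t name = and (SNNF-posPath φ _ _ _) (SNNF-posPath ψ _ _ _)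
  SNNF-posPath (φ ∨ᶠ ψ)    σ t name = or (SNNF-posPath φ _ _ _) (SNNF-posPath ψ _ _ _)
  SNNF-posPath (∃ᶠ φ)      σ t name = SNNF-posPath φ _ _ _

  mutual
    SNNF-nnfₛ⁺ : ∀ φ → SNNFₛ (nnfₛ⁺ φ)
    SNNF-nnfₛ⁺ (prop p)  = prop p
    SNNF-nnfₛ⁺ (¬ₛ φ)    = SNNF-nnfₛ⁻ φ
    SNNF-nnfₛ⁺ (φ ∧ₛ ψ)  = and (SNNF-nnfₛ⁺ φ) (SNNF-nnfₛ⁺ ψ)
    SNNF-nnfₛ⁺ (E ψ)     = exists (SNNF-nnfₚ⁺ ψ)

    SNNF-nnfₛ⁻ : ∀ φ → SNNFₛ (nnfₛ⁻ φ)
    SNNF-nnfₛ⁻ (prop p)  = negprop p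
    SNNF-nnfₛ⁻ (¬ₛ φ)    = SNNF-nnfₛ⁺ φ
    SNNF-nnfₛ⁻ (φ ∧ₛ ψ)  = or (SNNF-nnfₛ⁻ φ) (SNNF-nnfₛ⁻ ψ)
    SNNF-nnfₛ⁻ (E ψ)     = all (SNNF-nnfₚ⁻ ψ)

    SNNF-nnfₚ⁺ : ∀ ψ → SNNFₚ (nnfₚ⁺ ψ)
    SNNF-nnfₚ⁺ (st φ)        = state (SNNF-nnfₛ⁺ φ)
    SNNF-nnfₚ⁺ (¬ₚ ψ)        = SNNF-nnfₚ⁻ ψ
    SNNF-nnfₚ⁺ (ψ₁ ∧ₚ ψ₂)    = and (SNNF-nnfₚ⁺ ψ₁) (SNNF-nnfₚ⁺ ψ₂)
    SNNF-nnfₚ⁺ (X ψ)         = next (SNNF-nnfₚ⁺ ψ)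
    SNNF-nnfₚ⁺ (ψ₁ U ψ₂)     = until (SNNF-nnfₚ⁺ ψ₁) (SNNF-nnfₚ⁺ ψ₂)
    SNNF-nnfₚ⁺ (constr r ts) = constr r _

    SNNF-nnfₚ⁻ : ∀ ψ → SNNFₚ (nnfₚ⁻ ψ)
    SNNF-nnfₚ⁻ (st φ)        = state (SNNF-nnfₛ⁻ φ)
    SNNF-nnfₚ⁻ (¬ₚ ψ)        = SNNF-nnfₚ⁺ ψ
    SNNF-nnfₚ⁻ (ψ₁ ∧ₚ ψ₂)    = or (SNNF-nnfₚ⁻ ψ₁) (SNNF-nnfₚ⁻ ψ₂)
    SNNF-nnfₚ⁻ (X ψ)         = next (SNNF-nnfₚ⁻ ψ)
    SNNF-nnfₚ⁻ (ψ₁ U ψ₂)     = release (SNNF-nnfₚ⁻ ψ₁) (SNNF-nnfₚ⁻ ψ₂)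
    SNNF-nnfₚ⁻ (constr r ts) = SNNF-posPath (complementFormula r) _ _ _

  -- Positions outside the satisfied disjuncts, or not naming a quantifier, get the junk value d.
  witness : Carrier 𝒜 → ∀ {n} (φ : PosEx S n) {env} → ⟦_⟧ᶠ 𝒜 φ env → List ℕ → Carrier 𝒜
  witness d (φ ∧ᶠ ψ) (p , q)  (0 ∷ l) = witness d φ p l
  witness d (φ ∧ᶠ ψ) (p , q)  (1 ∷ l) = witness d ψ q l
  witness d (φ ∨ᶠ ψ) (inj₁ p) (0 ∷ l) = witness d φ p l
  witness d (φ ∨ᶠ ψ) (inj₂ q) (1 ∷ l) = witness d ψ q l
  witness d (∃ᶠ φ)   (a , p)  []      = a
  witness d (∃ᶠ φ)   (a , p)  (0 ∷ l) = witness d φ p l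
  witness d _        _        _       = d

  module _ (C : ConstraintGraph 𝒜) where
    open Semantics C

    posPath-complete : (d : Carrier 𝒜) → ∀ {n} (φ : PosEx S n) σ t name π {env} (p : ⟦_⟧ᶠ 𝒜 φ env) →
      map (termValue C π) σ ≡ env → (∀ l → γ C (seq π t) (name l) ≡ witness d φ p l) →
      π ⊨ₚ posPath φ σ t name
    posPath-complete d (atom r xs) σ t name π p refl _ = subst (I 𝒜 r) (sym (map-∘-lookup _ σ xs)) p
    posPath-complete d (φ ∧ᶠ ψ) σ t name π (p , q) σ≡ named =
      posPath-complete d φ σ t _ π p σ≡ (named ∘ (0 ∷_)) ,
      posPath-complete d ψ σ t _ π q σ≡ (named ∘ (1 ∷_))
    posPath-complete d (φ ∨ᶠ ψ) σ t name π (inj₁ p) σ≡ named (¬p , _) =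
      ¬p (posPath-complete d φ σ t _ π p σ≡ (named ∘ (0 ∷_)))
    posPath-complete d (φ ∨ᶠ ψ) σ t name π (inj₂ q) σ≡ named (_ , ¬q) =
      ¬q (posPath-complete d ψ σ t _ π q σ≡ (named ∘ (1 ∷_)))
    posPath-complete d (∃ᶠ φ) σ t name π (a , p) σ≡ named =
      posPath-complete d φ _ t _ π p (cong₂ _∷_ (named []) σ≡) (named ∘ (0 ∷_))

    posPath-sound : ExcludedMiddle 0ℓ → ∀ {n} (φ : PosEx S n) σ t name π →
      π ⊨ₚ posPath φ σ t name → ⟦_⟧ᶠ 𝒜 φ (map (termValue C π) σ)
    posPath-sound em (atom r xs) σ t name π h = subst (I 𝒜 r) (map-∘-lookup _ σ xs) h
    posPath-sound em (φ ∧ᶠ ψ) σ t name π (h₁ , h₂) =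
      posPath-sound em φ σ t _ π h₁ , posPath-sound em ψ σ t _ π h₂
    posPath-sound em (φ ∨ᶠ ψ) σ t name π h with em {π ⊨ₚ posPath φ σ t (name ∘ (0 ∷_))}
    ... | yes h₁ = inj₁ (posPath-sound em φ σ t _ π h₁)
    ... | no ¬h₁ = inj₂ (posPath-sound em ψ σ t _ π (em⇒dne em λ ¬h₂ → h (¬h₁ , ¬h₂)))
    posPath-sound em (∃ᶠ φ) σ t name π h = _ , posPath-sound em φ _ t _ π h

  module Restriction (em : ExcludedMiddle 0ℓ) (C : ConstraintGraph 𝒜) where

    C↓ : ConstraintGraph 𝒜
    C↓ = record { K = K C ; γ = λ v x → γ C v ⌜ orig x ⌝ }

    open Semantics C
    open Semantics C↓ renaming (_⊨ₛ_ to _⊨↓ₛ_; _⊨ₚ_ to _⊨↓ₚ_)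

    renamed-values : ∀ {n} π (ts : Vec Term n) →
      map (termValue C π) (map renameTerm ts) ≡ map (termValue C↓ π) ts
    renamed-values π ts = sym (map-∘ (termValue C π) renameTerm ts)

    mutual
      nnfₛ⁺-sound : ∀ φ v → v ⊨ₛ nnfₛ⁺ φ → v ⊨↓ₛ φ
      nnfₛ⁺-sound (prop p) v h = h
      nnfₛ⁺-sound (¬ₛ φ)   v h = nnfₛ⁻-sound φ v h
      nnfₛ⁺-sound (φ ∧ₛ ψ) v (h₁ , h₂) = nnfₛ⁺-sound φ v h₁ , nnfₛ⁺-sound ψ v h₂
      nnfₛ⁺-sound (E ψ)    v (π , π₀ , h) = π , π₀ , nnfₚ⁺-sound ψ π h

      nnfₛ⁻-sound : ∀ φ v → v ⊨ₛ nnfₛ⁻ φ → ¬ v ⊨↓ₛ φ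
      nnfₛ⁻-sound (prop p) v h = h
      nnfₛ⁻-sound (¬ₛ φ)   v h ¬φ = ¬φ (nnfₛ⁺-sound φ v h)
      nnfₛ⁻-sound (φ ∧ₛ ψ) v h (h₁ , h₂) =
        h ((λ h₁′ → nnfₛ⁻-sound φ v h₁′ h₁) , (λ h₂′ → nnfₛ⁻-sound ψ v h₂′ h₂))
      nnfₛ⁻-sound (E ψ)    v h (π , π₀ , hψ) = h (π , π₀ , λ h′ → nnfₚ⁻-sound ψ π h′ hψ)

      nnfₚ⁺-sound : ∀ ψ π → π ⊨ₚ nnfₚ⁺ ψ → π ⊨↓ₚ ψ
      nnfₚ⁺-sound (st φ)      π h = nnfₛ⁺-sound φ _ h
      nnfₚ⁺-sound (¬ₚ ψ)      π h = nnfₚ⁻-sound ψ π h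
      nnfₚ⁺-sound (ψ₁ ∧ₚ ψ₂)  π (h₁ , h₂) = nnfₚ⁺-sound ψ₁ π h₁ , nnfₚ⁺-sound ψ₂ π h₂
      nnfₚ⁺-sound (X ψ)       π h = nnfₚ⁺-sound ψ (suffix π 1) h
      nnfₚ⁺-sound (ψ₁ U ψ₂)   π (i , h₂ , h₁) =
        i , nnfₚ⁺-sound ψ₂ (suffix π i) h₂ , λ j j<i → nnfₚ⁺-sound ψ₁ (suffix π j) (h₁ j j<i)
      nnfₚ⁺-sound (constr r ts) π h = subst (I 𝒜 r) (renamed-values π ts) h

      nnfₚ⁻-sound : ∀ ψ π → π ⊨ₚ nnfₚ⁻ ψ → ¬ π ⊨↓ₚ ψ
      nnfₚ⁻-sound (st φ)      π h = nnfₛ⁻-sound φ _ h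
      nnfₚ⁻-sound (¬ₚ ψ)      π h ¬ψ = ¬ψ (nnfₚ⁺-sound ψ π h)
      nnfₚ⁻-sound (ψ₁ ∧ₚ ψ₂)  π h (h₁ , h₂) =
        h ((λ h₁′ → nnfₚ⁻-sound ψ₁ π h₁′ h₁) , (λ h₂′ → nnfₚ⁻-sound ψ₂ π h₂′ h₂))
      nnfₚ⁻-sound (X ψ)       π h = nnfₚ⁻-sound ψ (suffix π 1) h
      nnfₚ⁻-sound (ψ₁ U ψ₂)   π h (i , h₂ , h₁) =
        h (i , (λ h₂′ → nnfₚ⁻-sound ψ₂ (suffix π i) h₂′ h₂) ,
               λ j j<i h₁′ → nnfₚ⁻-sound ψ₁ (suffix π j) h₁′ (h₁ j j<i))
      nnfₚ⁻-sound (constr r ts) π h = Equivalence.from (complement⇔ r _)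
        (subst (⟦_⟧ᶠ 𝒜 (complementFormula r)) (renamed-values π ts)
          (posPath-sound C em (complementFormula r) _ _ _ π h))

  module Unfolding (em : ExcludedMiddle 0ℓ) (C : ConstraintGraph 𝒜) (d : Carrier 𝒜) where

    dne : ∀ {P : Set} → ¬ ¬ P → P
    dne = em⇒dne em

    -- the current node together with its predecessors, latest first
    History : Set
    History = D (K C) × List (D (K C))

    K↑ : Kripke
    K↑ = record
      { D     = History
      ; _⇒_   = λ h h′ → _⇒_ (K C) (proj₁ h) (proj₁ h′) × proj₂ h′ ≡ proj₁ h ∷ proj₂ h
      ; total = λ h → (proj₁ (total (K C) (proj₁ h)) , proj₁ h ∷ proj₂ h) , proj₂ (total (K C) (proj₁ h)) , refl
      ; ρ     = λ h → ρ (K C) (proj₁ h)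
      ; ρ-fin = proj₁ (ρ-fin (K C)) , λ h → proj₂ (ρ-fin (K C)) (proj₁ h)
      }

    ancestor : History → ℕ → D (K C)
    ancestor (v , _)      zero    = v
    ancestor (v , [])     (suc k) = v
    ancestor (_ , w ∷ ws) (suc k) = ancestor (w , ws) k

    -- Read at time maxTime ts, the value of Xⁱ x lies maxTime ts ∸ i steps back.
    valuesBefore : ∀ {n} → History → Vec Term n → Vec (Carrier 𝒜) n
    valuesBefore h ts = map (λ t → γ C (ancestor h (maxTime ts ∸ proj₁ t)) (proj₂ t)) ts

    complementWitness : (r : Sym S) → Vec (Carrier 𝒜) (ar S r) → List ℕ → Carrier 𝒜
    complementWitness r a with em {⟦_⟧ᶠ 𝒜 (complementFormula r) a}
    ... | yes p = witness d (complementFormula r) p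
    ... | no _  = λ _ → d

    complementWitness-spec : ∀ r a → ¬ I 𝒜 r a →
      Σ (⟦_⟧ᶠ 𝒜 (complementFormula r) a) λ p → ∀ l → complementWitness r a l ≡ witness d (complementFormula r) p l
    complementWitness-spec r a ¬Ia with em {⟦_⟧ᶠ 𝒜 (complementFormula r) a}
    ... | yes p = p , λ _ → refl
    ... | no ¬p = ⊥-elim (¬p (Equivalence.to (complement⇔ r a) ¬Ia))

    value : History → Name → Carrier 𝒜
    value h (orig x)       = γ C (proj₁ h) x
    value h (fresh r ts l) = complementWitness r (valuesBefore h ts) l

    γ↑ : History → Var → Carrier 𝒜
    γ↑ h y with em {Σ Name λ a → ⌜ a ⌝ ≡ y}
    ... | yes (a , _) = value h a
    ... | no _        = d

    γ↑-⌜⌝ : ∀ (h : History) a → γ↑ h ⌜ a ⌝ ≡ value h a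
    γ↑-⌜⌝ h a with em {Σ Name λ b → ⌜ b ⌝ ≡ ⌜ a ⌝}
    ... | yes (b , b≡a) = cong (value h) (⌜⌝-injective b a b≡a)
    ... | no ∄b         = ⊥-elim (∄b (a , refl))

    C↑ : ConstraintGraph 𝒜
    C↑ = record { K = K↑ ; γ = γ↑ }

    open Semantics C
    open Semantics C↑ renaming (_⊨ₛ_ to _⊨↑ₛ_; _⊨ₚ_ to _⊨↑ₚ_)

    record _LiesOver_ (π↑ : KPath K↑) (π : KPath (K C)) : Set where
      constructor liesOver
      field projects : ∀ i → proj₁ (seq π↑ i) ≡ seq π i

    open _LiesOver_

    suffix-LiesOver : ∀ {π↑ π} → π↑ LiesOver π → ∀ j → suffix π↑ j LiesOver suffix π j
    suffix-LiesOver over j = liesOver λ k → projects over (j + k)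

    project : KPath K↑ → KPath (K C)
    project π↑ = record { seq = proj₁ ∘ seq π↑ ; valid = proj₁ ∘ valid π↑ }

    lift : KPath (K C) → List (D (K C)) → KPath K↑
    lift π ws = record { seq = λ n → seq π n , past n ; valid = λ n → valid π n , refl }
      where
      past : ℕ → List (D (K C))
      past zero    = ws
      past (suc n) = seq π n ∷ past n

    ancestor-seq : ∀ (π↑ : KPath K↑) i k → ancestor (seq π↑ (k + i)) k ≡ proj₁ (seq π↑ i)
    ancestor-seq π↑ i zero    = refl
    ancestor-seq π↑ i (suc k) with seq π↑ (suc k + i) | proj₂ (valid π↑ (k + i))
    ... | _ , _ | refl = ancestor-seq π↑ i k

    map-cong-≤ : ∀ {B : Set} {n} (f g : Term → B) m (ts : Vec Term n) → maxTime ts ≤ m →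
      (∀ t → proj₁ t ≤ m → f t ≡ g t) → map f ts ≡ map g ts
    map-cong-≤ f g m []             _  _  = refl
    map-cong-≤ f g m ((i , x) ∷ ts) ≤m f≗g =
      cong₂ _∷_ (f≗g (i , x) (≤-trans (m≤m⊔n i (maxTime ts)) ≤m))
                (map-cong-≤ f g m ts (≤-trans (m≤n⊔m i (maxTime ts)) ≤m) f≗g)

    valuesBefore-LiesOver : ∀ {π↑ π} → π↑ LiesOver π → ∀ {n} (ts : Vec Term n) →
      valuesBefore (seq π↑ (maxTime ts)) ts ≡ map (termValue C π) ts
    valuesBefore-LiesOver {π↑} {π} over ts = map-cong-≤ _ _ (maxTime ts) ts ≤-refl λ (i , x) i≤m →
      cong (λ v → γ C v x) (begin
        ancestor (seq π↑ (maxTime ts)) (maxTime ts ∸ i)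
          ≡⟨ cong (λ s → ancestor (seq π↑ s) (maxTime ts ∸ i)) (m∸n+n≡m i≤m) ⟨
        ancestor (seq π↑ (maxTime ts ∸ i + i)) (maxTime ts ∸ i)
          ≡⟨ ancestor-seq π↑ i (maxTime ts ∸ i) ⟩
        proj₁ (seq π↑ i)
          ≡⟨ projects over i ⟩
        seq π i ∎)
      where open ≡-Reasoning

    renamed-values : ∀ {π↑ π} → π↑ LiesOver π → ∀ {n} (ts : Vec Term n) →
      map (termValue C↑ π↑) (map renameTerm ts) ≡ map (termValue C π) ts
    renamed-values {π↑} {π} over ts = trans (sym (map-∘ (termValue C↑ π↑) renameTerm ts))
      (map-cong (λ (i , x) → trans (γ↑-⌜⌝ (seq π↑ i) (orig x)) (cong (λ v → γ C v x) (projects over i))) ts)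

    negConstr-complete : ∀ {π↑ π} → π↑ LiesOver π → ∀ r ts →
      ¬ I 𝒜 r (map (termValue C π) ts) → π↑ ⊨↑ₚ negConstr r ts
    negConstr-complete {π↑} over r ts ¬I
      with p , p-named ← complementWitness-spec r _ (¬I ∘ subst (I 𝒜 r) (valuesBefore-LiesOver over ts)) =
      posPath-complete C↑ d (complementFormula r) _ _ _ π↑ p
        (trans (renamed-values over ts) (sym (valuesBefore-LiesOver over ts)))
        (λ l → trans (γ↑-⌜⌝ _ (fresh r ts l)) (p-named l))

    mutual
      nnfₛ⁺-complete : ∀ φ h → proj₁ h ⊨ₛ φ → h ⊨↑ₛ nnfₛ⁺ φ
      nnfₛ⁺-complete (prop p) h x = x
      nnfₛ⁺-complete (¬ₛ φ)   h ¬φ = nnfₛ⁻-complete φ h ¬φ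
      nnfₛ⁺-complete (φ ∧ₛ ψ) h (x , y) = nnfₛ⁺-complete φ h x , nnfₛ⁺-complete ψ h y
      nnfₛ⁺-complete (E ψ)    h (π , refl , x) =
        lift π (proj₂ h) , refl , nnfₚ⁺-complete ψ (liesOver {lift π (proj₂ h)} λ _ → refl) x

      nnfₛ⁻-complete : ∀ φ h → ¬ proj₁ h ⊨ₛ φ → h ⊨↑ₛ nnfₛ⁻ φ
      nnfₛ⁻-complete (prop p) h ¬p = ¬p
      nnfₛ⁻-complete (¬ₛ φ)   h ¬¬φ = nnfₛ⁺-complete φ h (dne ¬¬φ)
      nnfₛ⁻-complete (φ ∧ₛ ψ) h ¬φψ (¬φ′ , ¬ψ′) =
        ¬φ′ (nnfₛ⁻-complete φ h λ x → ¬ψ′ (nnfₛ⁻-complete ψ h λ y → ¬φψ (x , y)))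
      nnfₛ⁻-complete (E ψ)    h ¬Eψ (π↑ , refl , ¬ψ′) =
        ¬ψ′ (nnfₚ⁻-complete ψ (liesOver {π↑} {project π↑} λ _ → refl) λ x → ¬Eψ (project π↑ , refl , x))

      nnfₚ⁺-complete : ∀ ψ {π↑ π} → π↑ LiesOver π → π ⊨ₚ ψ → π↑ ⊨↑ₚ nnfₚ⁺ ψ
      nnfₚ⁺-complete (st φ) over x =
        nnfₛ⁺-complete φ _ (subst (_⊨ₛ φ) (sym (projects over 0)) x)
      nnfₚ⁺-complete (¬ₚ ψ)     over ¬ψ = nnfₚ⁻-complete ψ over ¬ψ
      nnfₚ⁺-complete (ψ₁ ∧ₚ ψ₂) over (x , y) =
        nnfₚ⁺-complete ψ₁ over x , nnfₚ⁺-complete ψ₂ over y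
      nnfₚ⁺-complete (X ψ)      over x = nnfₚ⁺-complete ψ (suffix-LiesOver over 1) x
      nnfₚ⁺-complete (ψ₁ U ψ₂)  over (i , y , x) =
        i , nnfₚ⁺-complete ψ₂ (suffix-LiesOver over i) y ,
        λ j j<i → nnfₚ⁺-complete ψ₁ (suffix-LiesOver over j) (x j j<i)
      nnfₚ⁺-complete (constr r ts) over x = subst (I 𝒜 r) (sym (renamed-values over ts)) x

      nnfₚ⁻-complete : ∀ ψ {π↑ π} → π↑ LiesOver π → ¬ π ⊨ₚ ψ → π↑ ⊨↑ₚ nnfₚ⁻ ψ
      nnfₚ⁻-complete (st φ) over ¬φ =
        nnfₛ⁻-complete φ _ (¬φ ∘ subst (_⊨ₛ φ) (projects over 0))
      nnfₚ⁻-complete (¬ₚ ψ)     over ¬¬ψ = nnfₚ⁺-complete ψ over (dne ¬¬ψ)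
      nnfₚ⁻-complete (ψ₁ ∧ₚ ψ₂) over ¬ψ₁ψ₂ (¬ψ₁′ , ¬ψ₂′) =
        ¬ψ₁′ (nnfₚ⁻-complete ψ₁ over λ x →
          ¬ψ₂′ (nnfₚ⁻-complete ψ₂ over λ y → ¬ψ₁ψ₂ (x , y)))
      nnfₚ⁻-complete (X ψ)      over ¬ψ = nnfₚ⁻-complete ψ (suffix-LiesOver over 1) ¬ψ
      nnfₚ⁻-complete (ψ₁ U ψ₂)  over ¬U (i , ¬ψ₂′ , ¬ψ₁′) =
        ¬U (i , dne (¬ψ₂′ ∘ nnfₚ⁻-complete ψ₂ (suffix-LiesOver over i)) ,
            λ j j<i → dne (¬ψ₁′ j j<i ∘ nnfₚ⁻-complete ψ₁ (suffix-LiesOver over j)))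
      nnfₚ⁻-complete (constr r ts) over ¬I = negConstr-complete over r ts ¬I

  nnf-satisfiable : ExcludedMiddle 0ℓ → ∀ φ → Satisfiable 𝒜 φ → Satisfiable 𝒜 (nnfₛ⁺ φ)
  nnf-satisfiable em φ (C , v , x) = C↑ , (v , []) , nnfₛ⁺-complete φ (v , []) x
    where open Unfolding em C (γ C v 0)

  satisfiable-nnf : ExcludedMiddle 0ℓ → ∀ φ → Satisfiable 𝒜 (nnfₛ⁺ φ) → Satisfiable 𝒜 φ
  satisfiable-nnf em φ (C , v , x) = C↓ , v , nnfₛ⁺-sound φ v x
    where open Restriction em C

lemma4 : (S : Signature) (𝒜 : Structure S) → NegationClosed 𝒜 →
    Σ (StateF S → StateF S) λ f →
    (∀ φ → SNNFₛ (f φ)) ×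
    (ExcludedMiddle 0ℓ → ∀ φ → Satisfiable 𝒜 φ ⇔ Satisfiable 𝒜 (f φ))
lemma4 S 𝒜 nc = nnfₛ⁺ , SNNF-nnfₛ⁺ , λ em φ → mk⇔ (nnf-satisfiable em φ) (satisfiable-nnf em φ)
  where open Translation nc
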